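{- For every sentence $\psi$ of $\mathcal{L}_T$: $\psi$ is WK-grounded iff $\psi$ is well-founded.
   Context: $\mathcal{L}_T$ is the language of first-order arithmetic (arithmetical language and Gödel coding fixed but arbitrary) extended by a one-place predicate $T$. Sentences are identified with codes; $Sent_T$: $\mathcal{L}_T$-sentences; $Tm^c$: closed terms; $val(t)$: value of $t$; $Th(\mathbb{N})$: true arithmetical sentences. For $S\subseteq\omega$, $\chi$ is determined in $S$ if $\chi\in S$ or $\neg\chi\in S$. The Weak Kleene jump $J^{WK}(S)$ is the set of sentences: $t=s$ with $val(t)=val(s)$; $\neg t=s$ with $val(t)\neq val(s)$; $T(t)$ with $val(t)\in S$; $\neg T(t)$ with $\neg val(t)\in S$ or $val(t)\notin Sent_T$; $\neg\neg\varphi$ with $\varphi\in S$; $\varphi\wedge\psi$ (resp. $\varphi\vee\psi$) with $\varphi,\psi$ determined in $S$ and both (resp. at least one) in $S$; $\neg(\varphi\wedge\psi)$ (resp. $\neg(\varphi\vee\psi)$) with $\varphi,\psi$ determined in $S$ and at least one (resp. both) of $\neg\varphi,\neg\psi$ in $S$; $\forall v\varphi$ (resp. $\exists v\varphi$) with all $\varphi(t)$, $t\in Tm^c$, determined in $S$ and all (resp. some) $\varphi(t)\in S$; $\neg\forall v\varphi$ (resp. $\neg\exists v\varphi$) with all $\varphi(t)$ determined in $S$ and some (resp. all) $\neg\varphi(t)\in S$. $T^{WK}_0=Th(\mathbb{N})$, $T^{WK}_{\alpha+1}=J^{WK}(T^{WK}_\alpha)$, unions at limits, $T^{WK}$ the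 least fixed point. $\psi$ is WK-grounded iff $\psi\in T^{WK}$ or $\neg\psi\in T^{WK}$. For sentences $x,y$, $x\vartriangleleft y$ holds iff $y=T(t)$ with $t\in Tm^c$ and $x=val(t)$ (a sentence), or $y=\neg x$, or $y=\varphi\circ\chi$ ($\circ\in\{\wedge,\vee\}$) and $x\in\{\varphi,\chi\}$, or $y=Qv\,\theta(v)$ ($Q\in\{\forall,\exists\}$) and $x=\theta(t)$ for some $t\in Tm^c$. $\vartriangleleft^*$ is the transitive closure of $\vartriangleleft$, and $\psi$ is well-founded iff $\vartriangleleft$ is well-founded on $\{x: x\trianglelefteq^*\psi\}$ (where $x\trianglelefteq^* y$ iff $x\vartriangleleft^* y$ or $x=y$). -}

module Defs where

open import Data.Nat using (ℕ; _+_; _*_) renaming (zero to nzero; suc to nsuc)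
open import Data.Fin using (Fin; zero; suc)
open import Data.Empty using (⊥)
open import Data.Unit using (⊤)
open import Data.Product using (Σ; ∃; _×_; proj₁)
open import Data.Sum using (_⊎_)
open import Relation.Nullary using (¬_)
open import Relation.Binary.PropositionalEquality using (_≡_; _≢_)
open import Relation.Binary.Construct.Closure.Transitive using (TransClosure)
open import Induction.WellFounded using (WellFounded)

data Term (n : ℕ) : Set where
  var  : Fin n → Term n
  zer  : Term n
  succ : Term n → Term n
  plus : Term n → Term n → Term n
  times : Term n → Term n → Term n

CTerm : Set
CTerm = Term 0

infix  7 _≐_
infixr 6 _∧'_
infixr 5 _∨'_

data Formula (n : ℕ) : Set where
  _≐_  : Term n → Term n → Formula n
  Tr   : Term n → Formula n
  ¬'_  : Formula n → Formula n
  _∧'_ : Formula n → Formula n → Formula n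
  _∨'_ : Formula n → Formula n → Formula n
  ∀'   : Formula (nsuc n) → Formula n
  ∃'   : Formula (nsuc n) → Formula n

Sent : Set
Sent = Formula 0

renT : ∀ {m n} → (Fin m → Fin n) → Term m → Term n
renT ρ (var i) = var (ρ i)
renT ρ zer = zer
renT ρ (succ t) = succ (renT ρ t)
renT ρ (plus t s) = plus (renT ρ t) (renT ρ s)
renT ρ (times t s) = times (renT ρ t) (renT ρ s)

subT : ∀ {m n} → (Fin m → Term n) → Term m → Term n
subT σ (var i) = σ i
subT σ zer = zer
subT σ (succ t) = succ (subT σ t)
subT σ (plus t s) = plus (subT σ t) (subT σ s)
subT σ (times t s) = times (subT σ t) (subT σ s)

liftS : ∀ {m n} → (Fin m → Term n) → Fin (nsuc m) → Term (nsuc n)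
liftS σ zero = var zero
liftS σ (suc i) = renT suc (σ i)

subF : ∀ {m n} → (Fin m → Term n) → Formula m → Formula n
subF σ (t ≐ s) = subT σ t ≐ subT σ s
subF σ (Tr t) = Tr (subT σ t)
subF σ (¬' φ) = ¬' subF σ φ
subF σ (φ ∧' ψ) = subF σ φ ∧' subF σ ψ
subF σ (φ ∨' ψ) = subF σ φ ∨' subF σ ψ
subF σ (∀' φ) = ∀' (subF (liftS σ) φ)
subF σ (∃' φ) = ∃' (subF (liftS σ) φ)

inst : Formula 1 → CTerm → Sent
inst θ t = subF (λ _ → t) θ

evalT : ∀ {n} → (Fin n → ℕ) → Term n → ℕ
evalT ρ (var i) = ρ i
evalT ρ zer = nzero
evalT ρ (succ t) = nsuc (evalT ρ t)
evalT ρ (plus t s) = evalT ρ t + evalT ρ s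
evalT ρ (times t s) = evalT ρ t * evalT ρ s

val : CTerm → ℕ
val = evalT (λ ())

extend : ∀ {n} → ℕ → (Fin n → ℕ) → Fin (nsuc n) → ℕ
extend k ρ zero = k
extend k ρ (suc i) = ρ i

Arith : ∀ {n} → Formula n → Set
Arith (t ≐ s) = ⊤
Arith (Tr t) = ⊥
Arith (¬' φ) = Arith φ
Arith (φ ∧' ψ) = Arith φ × Arith ψ
Arith (φ ∨' ψ) = Arith φ × Arith ψ
Arith (∀' φ) = Arith φ
Arith (∃' φ) = Arith φ

-- Tarski satisfaction in the standard model (T is only ever evaluated on
-- arithmetical formulas below; its clause is irrelevant)
Sat : ∀ {n} → (Fin n → ℕ) → Formula n → Set
Sat ρ (t ≐ s) = evalT ρ t ≡ evalT ρ s
Sat ρ (Tr t) = ⊥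
Sat ρ (¬' φ) = ¬ Sat ρ φ
Sat ρ (φ ∧' ψ) = Sat ρ φ × Sat ρ ψ
Sat ρ (φ ∨' ψ) = Sat ρ φ ⊎ Sat ρ ψ
Sat ρ (∀' φ) = (k : ℕ) → Sat (extend k ρ) φ
Sat ρ (∃' φ) = Σ ℕ (λ k → Sat (extend k ρ) φ)

ThN : Sent → Set
ThN φ = Arith φ × Sat (λ ()) φ

module _ (code : Sent → ℕ) where

  Det : (Sent → Set) → Sent → Set
  Det S χ = S χ ⊎ S (¬' χ)

  data JWK (S : Sent → Set) : Sent → Set where
    j-eq   : ∀ {t s} → val t ≡ val s → JWK S (t ≐ s)
    j-neq  : ∀ {t s} → val t ≢ val s → JWK S (¬' (t ≐ s))
    j-T    : ∀ {t} φ → code φ ≡ val t → S φ → JWK S (Tr t)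
    j-¬T   : ∀ {t} φ → code φ ≡ val t → S (¬' φ) → JWK S (¬' Tr t)
    j-¬Tns : ∀ {t} → (∀ φ → code φ ≢ val t) → JWK S (¬' Tr t)
    j-¬¬   : ∀ {φ} → S φ → JWK S (¬' ¬' φ)
    j-∧    : ∀ {φ ψ} → Det S φ → Det S ψ → S φ → S ψ → JWK S (φ ∧' ψ)
    j-∨    : ∀ {φ ψ} → Det S φ → Det S ψ → S φ ⊎ S ψ → JWK S (φ ∨' ψ)
    j-¬∧   : ∀ {φ ψ} → Det S φ → Det S ψ → S (¬' φ) ⊎ S (¬' ψ) → JWK S (¬' (φ ∧' ψ))
    j-¬∨   : ∀ {φ ψ} → Det S φ → Det S ψ → S (¬' φ) → S (¬' ψ) → JWK S (¬' (φ ∨' ψ))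
    j-∀    : ∀ {θ} → (∀ t → Det S (inst θ t)) → (∀ t → S (inst θ t)) → JWK S (∀' θ)
    j-∃    : ∀ {θ} → (∀ t → Det S (inst θ t)) → Σ CTerm (λ t → S (inst θ t)) → JWK S (∃' θ)
    j-¬∀   : ∀ {θ} → (∀ t → Det S (inst θ t)) → Σ CTerm (λ t → S (¬' inst θ t)) → JWK S (¬' ∀' θ)
    j-¬∃   : ∀ {θ} → (∀ t → Det S (inst θ t)) → (∀ t → S (¬' inst θ t)) → JWK S (¬' ∃' θ)

  -- T^WK: the least fixed point of the iteration T_0 = Th(ℕ), T_{α+1} = J(T_α),
  -- i.e. the least S with Th(ℕ) ⊆ S and J^WK(S) ⊆ S.
  data TWK : Sent → Set where
    twk-base : ∀ {φ} → ThN φ → TWK φ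
    twk-jump : ∀ {φ} → JWK TWK φ → TWK φ

  WKGrounded : Sent → Set
  WKGrounded ψ = TWK ψ ⊎ TWK (¬' ψ)

  data _◁_ : Sent → Sent → Set where
    ◁-T  : ∀ {x t} → code x ≡ val t → x ◁ Tr t
    ◁-¬  : ∀ {x} → x ◁ (¬' x)
    ◁-∧l : ∀ {φ χ} → φ ◁ (φ ∧' χ)
    ◁-∧r : ∀ {φ χ} → χ ◁ (φ ∧' χ)
    ◁-∨l : ∀ {φ χ} → φ ◁ (φ ∨' χ)
    ◁-∨r : ∀ {φ χ} → χ ◁ (φ ∨' χ)
    ◁-∀  : ∀ {θ} (t : CTerm) → inst θ t ◁ ∀' θ
    ◁-∃  : ∀ {θ} (t : CTerm) → inst θ t ◁ ∃' θ

  _⊴*_ : Sent → Sent → Set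
  x ⊴* y = TransClosure _◁_ x y ⊎ x ≡ y

  WellFoundedSent : Sent → Set
  WellFoundedSent ψ =
    WellFounded {A = Σ Sent (λ x → x ⊴* ψ)} (λ a b → proj₁ a ◁ proj₁ b)

module Submission where

open import Defs
open import Data.Nat using (ℕ)
open import Level using (0ℓ)
open import Relation.Binary.PropositionalEquality using (_≡_)
open import Function.Definitions using (Injective)
open import Function.Bundles using (_⇔_)
open import Axiom.ExcludedMiddle using (ExcludedMiddle)

open import Data.Nat using (suc; _+_; _<_; s≤s; _≟_)
open import Data.Nat.Properties using (≤-reflexive; n<1+n; m≤m+n; m≤n+m)
open import Data.Nat.Induction using (<-wellFounded)
open import Data.Fin using (Fin)
open import Data.Empty using (⊥-elim)
open import Data.Product using (Σ; _×_; _,_; proj₁)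
open import Data.Sum using (_⊎_; inj₁; inj₂; fromInj₁; fromInj₂)
open import Function.Base using (_on_; _∘_)
open import Function.Bundles using (Equivalence; mk⇔)
open import Relation.Binary.Core using (Rel)
open import Relation.Binary.PropositionalEquality using (_≢_; refl; sym; trans; subst; cong; cong₂)
open import Relation.Binary.Construct.Closure.Transitive using (TransClosure; [_]; _∷_; accessible; accessible⁻)
open import Relation.Nullary using (yes; no)
open import Induction.WellFounded using (WellFounded; Acc; acc; acc-inverse)
import Relation.Binary.Construct.On as On

-- Both directions go by induction: a grounded sentence enters T^WK only once all its
-- ◁-predecessors are determined, so ◁-chains below it are finite; conversely, with excluded
-- middle, well-founded induction along ◁ shows that every predecessor of an accessible
-- sentence is determined, and then one more jump determines the sentence itself. The
-- arithmetical base case is accessible because ◁ shrinks arithmetical sentences.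

module _ {a ℓ} {A : Set a} {_<_ : Rel A ℓ} where

  acc-downward : ∀ {x y} → TransClosure _<_ y x → Acc _<_ x → Acc _<_ y
  acc-downward y<⁺x acc-x = accessible⁻ _<_ (acc-inverse (accessible _<_ acc-x) y<⁺x)

  acc-of-restriction : ∀ {x y} {y≤x : TransClosure _<_ y x ⊎ y ≡ x} →
                       Acc (_<_ on proj₁) (y , y≤x) → Acc _<_ y
  acc-of-restriction {y≤x = y≤x} (acc rs) = acc λ z<y → acc-of-restriction (rs {_ , below z<y y≤x} z<y)
    where
    below : ∀ {x y z} → z < y → TransClosure _<_ y x ⊎ y ≡ x → TransClosure _<_ z x ⊎ z ≡ x
    below z<y (inj₁ y<⁺x) = inj₁ (z<y ∷ y<⁺x)
    below z<y (inj₂ refl) = inj₁ [ z<y ]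

  acc⇔wellFounded-below : ∀ x → Acc _<_ x ⇔
    WellFounded {A = Σ A (λ y → TransClosure _<_ y x ⊎ y ≡ x)} (_<_ on proj₁)
  acc⇔wellFounded-below x = mk⇔
    (λ acc-x → λ where
      (y , inj₁ y<⁺x) → On.accessible proj₁ (acc-downward y<⁺x acc-x)
      (y , inj₂ refl) → On.accessible proj₁ acc-x)
    (λ wf → acc-of-restriction (wf (x , inj₂ refl)))

size : ∀ {n} → Formula n → ℕ
size (t ≐ s) = 0
size (Tr t) = 0
size (¬' φ) = suc (size φ)
size (φ ∧' ψ) = suc (size φ + size ψ)
size (φ ∨' ψ) = suc (size φ + size ψ)
size (∀' φ) = suc (size φ)
size (∃' φ) = suc (size φ)

size-subF : ∀ {m n} (σ : Fin m → Term n) φ → size (subF σ φ) ≡ size φ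
size-subF σ (t ≐ s) = refl
size-subF σ (Tr t) = refl
size-subF σ (¬' φ) = cong suc (size-subF σ φ)
size-subF σ (φ ∧' ψ) = cong suc (cong₂ _+_ (size-subF σ φ) (size-subF σ ψ))
size-subF σ (φ ∨' ψ) = cong suc (cong₂ _+_ (size-subF σ φ) (size-subF σ ψ))
size-subF σ (∀' φ) = cong suc (size-subF (liftS σ) φ)
size-subF σ (∃' φ) = cong suc (size-subF (liftS σ) φ)

Arith-subF : ∀ {m n} (σ : Fin m → Term n) φ → Arith φ → Arith (subF σ φ)
Arith-subF σ (t ≐ s) a = a
Arith-subF σ (Tr t) ()
Arith-subF σ (¬' φ) a = Arith-subF σ φ a
Arith-subF σ (φ ∧' ψ) (a , b) = Arith-subF σ φ a , Arith-subF σ ψ b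
Arith-subF σ (φ ∨' ψ) (a , b) = Arith-subF σ φ a , Arith-subF σ ψ b
Arith-subF σ (∀' φ) a = Arith-subF (liftS σ) φ a
Arith-subF σ (∃' φ) a = Arith-subF (liftS σ) φ a

size-inst : ∀ θ t → size (inst θ t) < suc (size θ)
size-inst θ t = s≤s (≤-reflexive (size-subF (λ _ → t) θ))

module _ (code : Sent → ℕ) where

  ◁-Arith : ∀ {x y} → Arith y → _◁_ code x y → Arith x × size x < size y
  ◁-Arith () (◁-T _)
  ◁-Arith a ◁-¬ = a , n<1+n _
  ◁-Arith (a , _) ◁-∧l = a , s≤s (m≤m+n _ _)
  ◁-Arith (_ , b) ◁-∧r = b , s≤s (m≤n+m _ _)
  ◁-Arith (a , _) ◁-∨l = a , s≤s (m≤m+n _ _)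
  ◁-Arith (_ , b) ◁-∨r = b , s≤s (m≤n+m _ _)
  ◁-Arith {y = ∀' θ} a (◁-∀ t) = Arith-subF (λ _ → t) θ a , size-inst θ t
  ◁-Arith {y = ∃' θ} a (◁-∃ t) = Arith-subF (λ _ → t) θ a , size-inst θ t

  Arith⇒acc : ∀ {φ} → Acc _<_ (size φ) → Arith φ → Acc (_◁_ code) φ
  Arith⇒acc (acc rs) a = acc λ x◁φ → let a′ , smaller = ◁-Arith a x◁φ in Arith⇒acc (rs smaller) a′

  ≐-acc : ∀ {t s} → Acc (_◁_ code) (t ≐ s)
  ≐-acc = acc λ ()

  ¬-acc : ∀ {φ} → Acc (_◁_ code) φ → Acc (_◁_ code) (¬' φ)
  ¬-acc acc-φ = acc λ { ◁-¬ → acc-φ }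

  ∧-acc : ∀ {φ χ} → Acc (_◁_ code) φ → Acc (_◁_ code) χ → Acc (_◁_ code) (φ ∧' χ)
  ∧-acc acc-φ acc-χ = acc λ { ◁-∧l → acc-φ ; ◁-∧r → acc-χ }

  ∨-acc : ∀ {φ χ} → Acc (_◁_ code) φ → Acc (_◁_ code) χ → Acc (_◁_ code) (φ ∨' χ)
  ∨-acc acc-φ acc-χ = acc λ { ◁-∨l → acc-φ ; ◁-∨r → acc-χ }

  ∀-acc : ∀ {θ} → (∀ t → Acc (_◁_ code) (inst θ t)) → Acc (_◁_ code) (∀' θ)
  ∀-acc acc-θ = acc λ { (◁-∀ t) → acc-θ t }

  ∃-acc : ∀ {θ} → (∀ t → Acc (_◁_ code) (inst θ t)) → Acc (_◁_ code) (∃' θ)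
  ∃-acc acc-θ = acc λ { (◁-∃ t) → acc-θ t }

  Tr-acc-nonsentence : ∀ {t} → (∀ φ → code φ ≢ val t) → Acc (_◁_ code) (Tr t)
  Tr-acc-nonsentence no-φ = acc λ { (◁-T e) → ⊥-elim (no-φ _ e) }

  module _ (code-injective : Injective _≡_ _≡_ code) where

    Tr-acc : ∀ {φ t} → code φ ≡ val t → Acc (_◁_ code) φ → Acc (_◁_ code) (Tr t)
    Tr-acc e acc-φ = acc λ { (◁-T e′) → subst (Acc (_◁_ code)) (code-injective (trans e (sym e′))) acc-φ }

    mutual
      TWK⇒acc : ∀ {φ} → TWK code φ → Acc (_◁_ code) φ
      TWK⇒acc (twk-base (a , _)) = Arith⇒acc (<-wellFounded _) a
      TWK⇒acc (twk-jump j) = JWK⇒acc j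

      Det⇒acc : ∀ {φ} → Det code (TWK code) φ → Acc (_◁_ code) φ
      Det⇒acc (inj₁ φ∈T) = TWK⇒acc φ∈T
      Det⇒acc (inj₂ ¬φ∈T) = acc-inverse (TWK⇒acc ¬φ∈T) ◁-¬

      JWK⇒acc : ∀ {φ} → JWK code (TWK code) φ → Acc (_◁_ code) φ
      JWK⇒acc (j-eq _) = ≐-acc
      JWK⇒acc (j-neq _) = ¬-acc ≐-acc
      JWK⇒acc (j-T _ e φ∈T) = Tr-acc e (TWK⇒acc φ∈T)
      JWK⇒acc (j-¬T _ e ¬φ∈T) = ¬-acc (Tr-acc e (Det⇒acc (inj₂ ¬φ∈T)))
      JWK⇒acc (j-¬Tns no-φ) = ¬-acc (Tr-acc-nonsentence no-φ)
      JWK⇒acc (j-¬¬ φ∈T) = ¬-acc (¬-acc (TWK⇒acc φ∈T))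
      JWK⇒acc (j-∧ dφ dχ _ _) = ∧-acc (Det⇒acc dφ) (Det⇒acc dχ)
      JWK⇒acc (j-∨ dφ dχ _) = ∨-acc (Det⇒acc dφ) (Det⇒acc dχ)
      JWK⇒acc (j-¬∧ dφ dχ _) = ¬-acc (∧-acc (Det⇒acc dφ) (Det⇒acc dχ))
      JWK⇒acc (j-¬∨ dφ dχ _ _) = ¬-acc (∨-acc (Det⇒acc dφ) (Det⇒acc dχ))
      JWK⇒acc (j-∀ d _) = ∀-acc (λ t → Det⇒acc (d t))
      JWK⇒acc (j-∃ d _) = ∃-acc (λ t → Det⇒acc (d t))
      JWK⇒acc (j-¬∀ d _) = ¬-acc (∀-acc (λ t → Det⇒acc (d t)))
      JWK⇒acc (j-¬∃ d _) = ¬-acc (∃-acc (λ t → Det⇒acc (d t)))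

    WKGrounded⇒acc : ∀ {ψ} → WKGrounded code ψ → Acc (_◁_ code) ψ
    WKGrounded⇒acc = Det⇒acc

  grounded-≐ : ∀ t s → WKGrounded code (t ≐ s)
  grounded-≐ t s with val t ≟ val s
  ... | yes eq = inj₁ (twk-jump (j-eq eq))
  ... | no neq = inj₂ (twk-jump (j-neq neq))

  grounded-¬ : ∀ {φ} → WKGrounded code φ → WKGrounded code (¬' φ)
  grounded-¬ (inj₁ φ∈T) = inj₂ (twk-jump (j-¬¬ φ∈T))
  grounded-¬ (inj₂ ¬φ∈T) = inj₁ ¬φ∈T

  grounded-∧ : ∀ {φ χ} → WKGrounded code φ → WKGrounded code χ → WKGrounded code (φ ∧' χ)
  grounded-∧ gφ@(inj₁ φ∈T) gχ@(inj₁ χ∈T) = inj₁ (twk-jump (j-∧ gφ gχ φ∈T χ∈T))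
  grounded-∧ gφ@(inj₂ ¬φ∈T) gχ = inj₂ (twk-jump (j-¬∧ gφ gχ (inj₁ ¬φ∈T)))
  grounded-∧ gφ@(inj₁ _) gχ@(inj₂ ¬χ∈T) = inj₂ (twk-jump (j-¬∧ gφ gχ (inj₂ ¬χ∈T)))

  grounded-∨ : ∀ {φ χ} → WKGrounded code φ → WKGrounded code χ → WKGrounded code (φ ∨' χ)
  grounded-∨ gφ@(inj₂ ¬φ∈T) gχ@(inj₂ ¬χ∈T) = inj₂ (twk-jump (j-¬∨ gφ gχ ¬φ∈T ¬χ∈T))
  grounded-∨ gφ@(inj₁ φ∈T) gχ = inj₁ (twk-jump (j-∨ gφ gχ (inj₁ φ∈T)))
  grounded-∨ gφ@(inj₂ _) gχ@(inj₁ χ∈T) = inj₁ (twk-jump (j-∨ gφ gχ (inj₂ χ∈T)))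

  module _ (lem : ExcludedMiddle 0ℓ) where

    grounded-Tr : ∀ {t} → (∀ {φ} → code φ ≡ val t → WKGrounded code φ) → WKGrounded code (Tr t)
    grounded-Tr {t} g with lem {Σ Sent λ φ → code φ ≡ val t}
    ... | no ∄φ = inj₂ (twk-jump (j-¬Tns λ φ e → ∄φ (φ , e)))
    ... | yes (φ , e) with g e
    ...   | inj₁ φ∈T = inj₁ (twk-jump (j-T φ e φ∈T))
    ...   | inj₂ ¬φ∈T = inj₂ (twk-jump (j-¬T φ e ¬φ∈T))

    grounded-∀ : ∀ {θ} → (∀ t → WKGrounded code (inst θ t)) → WKGrounded code (∀' θ)
    grounded-∀ {θ} g with lem {Σ CTerm λ t → TWK code (¬' inst θ t)}
    ... | yes counterexample = inj₂ (twk-jump (j-¬∀ g counterexample))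
    ... | no ∄t = inj₁ (twk-jump (j-∀ g λ t → fromInj₁ (λ ¬θt∈T → ⊥-elim (∄t (t , ¬θt∈T))) (g t)))

    grounded-∃ : ∀ {θ} → (∀ t → WKGrounded code (inst θ t)) → WKGrounded code (∃' θ)
    grounded-∃ {θ} g with lem {Σ CTerm λ t → TWK code (inst θ t)}
    ... | yes witness = inj₁ (twk-jump (j-∃ g witness))
    ... | no ∄t = inj₂ (twk-jump (j-¬∃ g λ t → fromInj₂ (λ θt∈T → ⊥-elim (∄t (t , θt∈T))) (g t)))

    acc⇒WKGrounded : ∀ {ψ} → Acc (_◁_ code) ψ → WKGrounded code ψ
    acc⇒WKGrounded {t ≐ s} _ = grounded-≐ t s
    acc⇒WKGrounded {Tr t} (acc rs) = grounded-Tr λ e → acc⇒WKGrounded (rs (◁-T e))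
    acc⇒WKGrounded {¬' φ} (acc rs) = grounded-¬ (acc⇒WKGrounded (rs ◁-¬))
    acc⇒WKGrounded {φ ∧' χ} (acc rs) = grounded-∧ (acc⇒WKGrounded (rs ◁-∧l)) (acc⇒WKGrounded (rs ◁-∧r))
    acc⇒WKGrounded {φ ∨' χ} (acc rs) = grounded-∨ (acc⇒WKGrounded (rs ◁-∨l)) (acc⇒WKGrounded (rs ◁-∨r))
    acc⇒WKGrounded {∀' θ} (acc rs) = grounded-∀ λ t → acc⇒WKGrounded (rs (◁-∀ t))
    acc⇒WKGrounded {∃' θ} (acc rs) = grounded-∃ λ t → acc⇒WKGrounded (rs (◁-∃ t))

lemma5p3 : ExcludedMiddle 0ℓ → (code : Sent → ℕ) → Injective _≡_ _≡_ code →
             (ψ : Sent) → WKGrounded code ψ ⇔ WellFoundedSent code ψ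
lemma5p3 lem code code-injective ψ = mk⇔
  (to ∘ WKGrounded⇒acc code code-injective)
  (acc⇒WKGrounded code lem ∘ from)
  where open Equivalence (acc⇔wellFounded-below {_<_ = _◁_ code} ψ)
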